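{- Let $G$ be a strong $1$-central $2$-tree on $n$ vertices with maximum degree $\Delta$ and tail set $\{2,3\}$, and let $x$ and $y$ be the numbers of tail vertices of degree $3$ and of degree $2$, respectively. Then $x=2n-4-\Delta$ and $y=\Delta-n+3$.
   Context: A $2$-tree is a graph obtained from the triangle $K_3$ by repeatedly adding a new vertex adjacent to both endpoints of an existing edge. For $r\in\{1,2,3\}$ and an integer $\Delta\ge 2$, a $2$-tree on $n$ vertices is $r$-central with maximum degree $\Delta$ if $\Delta$ is its maximum degree and exactly $r$ vertices have degree $\Delta$; these $r$ vertices form the core and the other $n-r$ vertices form the tail. It is strong if the core induces $K_r$. It has tail set $\{2,3\}$ if every tail vertex has degree $2$ or $3$. -}

module Defs where

open import Data.Nat using (ℕ; zero; suc; _≤_)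
open import Data.Bool using (Bool; true; false; not; _∨_; if_then_else_)
open import Data.Fin using (Fin; zero; suc)
open import Data.Fin.Properties using (_≟_)
open import Data.List using (List; map; sum; filter; length)
open import Data.List.Base using (allFin)
open import Data.Sum using (_⊎_)
open import Data.Product using (Σ; ∃; _×_; _,_)
open import Relation.Nullary using (¬_)
open import Relation.Nullary.Decidable using (isYes)
open import Relation.Binary.PropositionalEquality using (_≡_)
open import Function.Bundles using (_↔_; Inverse)

Graph : ℕ → Set
Graph n = Fin n → Fin n → Bool

_==_ : ∀ {n} → Fin n → Fin n → Bool
i == j = isYes (i ≟ j)

triangle : Graph 3
triangle i j = not (i == j)

extend : ∀ {n} → Graph n → Fin n → Fin n → Graph (suc n)
extend G u v zero    zero    = false
extend G u v zero    (suc j) = (j == u) ∨ (v == j)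
extend G u v (suc i) zero    = (i == u) ∨ (v == i)
extend G u v (suc i) (suc j) = G i j

-- Graphs produced by the 2-tree construction (with a fixed labelling).
data Built2Tree : (n : ℕ) → Graph n → Set where
  base : Built2Tree 3 triangle
  step : ∀ {n} {G : Graph n} (u v : Fin n) →
         Built2Tree n G → G u v ≡ true → Built2Tree (suc n) (extend G u v)

Isomorphic : ∀ {n} → Graph n → Graph n → Set
Isomorphic {n} G H =
  Σ (Fin n ↔ Fin n) λ σ →
    ∀ i j → G i j ≡ H (Inverse.to σ i) (Inverse.to σ j)

Is2Tree : ∀ {n} → Graph n → Set
Is2Tree {n} G = Σ (Graph n) λ H → Built2Tree n H × Isomorphic G H

deg : ∀ {n} → Graph n → Fin n → ℕ
deg {n} G u = length (filter (λ v → G u v ≟b true) (allFin n))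
  where open import Data.Bool.Properties renaming (_≟_ to _≟b_)

-- G is 1-central with maximum degree Δ and core vertex c:
-- Δ ≥ 2 is the maximum degree, and c is the unique vertex of degree Δ.
-- (Strong is automatic for r = 1: the core induces K₁.)
OneCentral : ∀ {n} → Graph n → ℕ → Fin n → Set
OneCentral {n} G Δ c =
  2 ≤ Δ × (∀ v → deg G v ≤ Δ) × deg G c ≡ Δ × (∀ v → deg G v ≡ Δ → v ≡ c)

TailSet23 : ∀ {n} → Graph n → Fin n → Set
TailSet23 {n} G c = ∀ v → ¬ v ≡ c → (deg G v ≡ 2 ⊎ deg G v ≡ 3)

tailCount : ∀ {n} → Graph n → Fin n → ℕ → ℕ
tailCount {n} G c d =
  length (filter (λ v → (¬? (v ≟ c)) ×-dec (deg G v Data.Nat.≟ d)) (allFin n))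
  where
  open import Relation.Nullary using (¬?)
  open import Relation.Nullary.Decidable using (_×-dec_)
  import Data.Nat

{-# OPTIONS --safe #-}
-- Double counting of degrees. Each step of the 2-tree construction adds a vertex of
-- degree 2 and raises two old degrees by 1, so every 2-tree on n vertices has degree
-- sum 4n − 6 (an isomorphism only permutes the summands). In a 1-central 2-tree with
-- tail set {2,3} that sum is also Δ + 2y + 3x, and n = 1 + y + x; this linear system
-- determines x and y.
module Submission where

open import Defs
open import Data.Nat using (ℕ)
open import Data.Fin using (Fin)
open import Data.Integer using (ℤ; +_; _-_; _+_)
open import Relation.Binary.PropositionalEquality using (_≡_)
import Data.Product

open import Data.Nat as ℕ using (zero; suc; _*_)
open import Data.Nat.Properties using (+-*-semiring; +-assoc; +-cancelʳ-≡; *-suc; *-identityˡ; *-identityʳ)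
import Data.Integer.Properties as ℤ
open import Data.Nat.Tactic.RingSolver using (solve-∀; solve)
import Data.Integer.Tactic.RingSolver as ℤ-Solver
open import Data.Fin using (zero; suc)
open import Data.Fin.Properties using (_≟_)
open import Data.Bool using (Bool; true; false; _∨_)
import Data.Bool.Properties as Bool
open import Data.List using ([]; _∷_; length; filter; tabulate; allFin)
open import Data.Product using (_×_; _,_; proj₁; proj₂; map)
open import Data.Sum using (inj₁; inj₂)
open import Data.Vec.Functional using (replicate)
open import Function using (id; const)
open import Function.Bundles using (Inverse)
open import Level using (0ℓ)
open import Relation.Nullary using (yes; no; does; ¬_; ¬?; contradiction)
open import Relation.Nullary.Decidable using (_×-dec_)
open import Relation.Unary using (Pred; Decidable)
open import Relation.Binary.PropositionalEquality using (refl; sym; trans; cong; cong₂; module ≡-Reasoning)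
open import Algebra.Properties.Semiring.Sum +-*-semiring
  using (sum; sum-syntax; sum-cong-≗; ∑-distrib-+; *-distribˡ-sum; sum-permute; sum-replicate-zero)

𝟙 : Bool → ℕ
𝟙 true  = 1
𝟙 false = 0

length-filter-allFin : ∀ {n} {P : Pred (Fin n) 0ℓ} (P? : Decidable P) →
  length (filter P? (allFin n)) ≡ ∑[ v < n ] 𝟙 (does (P? v))
length-filter-allFin {n} P? = length-filter-tabulate id
  where
  length-filter-tabulate : ∀ {m} (g : Fin m → Fin n) →
    length (filter P? (tabulate g)) ≡ ∑[ i < m ] 𝟙 (does (P? (g i)))
  length-filter-tabulate {zero}  g = refl
  length-filter-tabulate {suc m} g with does (P? (g zero))
  ... | true  = cong suc (length-filter-tabulate (λ i → g (suc i)))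
  ... | false = length-filter-tabulate (λ i → g (suc i))

sum-replicate-one : ∀ n → sum (replicate n 1) ≡ n
sum-replicate-one zero    = refl
sum-replicate-one (suc n) = cong suc (sum-replicate-one n)

∑-linear₃ : ∀ {n} a b c (f g h : Fin n → ℕ) →
  ∑[ i < n ] (a * f i ℕ.+ b * g i ℕ.+ c * h i) ≡ a * sum f ℕ.+ b * sum g ℕ.+ c * sum h
∑-linear₃ a b c f g h = begin
  ∑[ i < _ ] (a * f i ℕ.+ b * g i ℕ.+ c * h i)
    ≡⟨ ∑-distrib-+ (λ i → a * f i ℕ.+ b * g i) (λ i → c * h i) ⟩
  (∑[ i < _ ] (a * f i ℕ.+ b * g i)) ℕ.+ (∑[ i < _ ] (c * h i))
    ≡⟨ cong (ℕ._+ _) (∑-distrib-+ (λ i → a * f i) (λ i → b * g i)) ⟩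
  (∑[ i < _ ] (a * f i)) ℕ.+ (∑[ i < _ ] (b * g i)) ℕ.+ (∑[ i < _ ] (c * h i))
    ≡⟨ sym (cong₂ ℕ._+_ (cong₂ ℕ._+_ (*-distribˡ-sum a f) (*-distribˡ-sum b g)) (*-distribˡ-sum c h)) ⟩
  a * sum f ℕ.+ b * sum g ℕ.+ c * sum h ∎
  where open ≡-Reasoning

==-suc : ∀ {n} (i j : Fin n) → (suc i == suc j) ≡ (i == j)
==-suc i j with i ≟ j
... | yes _ = refl
... | no  _ = refl

==-sym : ∀ {n} (i j : Fin n) → (i == j) ≡ (j == i)
==-sym i j with i ≟ j | j ≟ i
... | yes _    | yes _   = refl
... | no  _    | no  _   = refl
... | yes refl | no j≢i  = contradiction refl j≢i
... | no  i≢j  | yes refl = contradiction refl i≢j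

∑-𝟙-== : ∀ {n} (u : Fin n) → ∑[ j < n ] 𝟙 (j == u) ≡ 1
∑-𝟙-== {suc n} zero    = cong suc (sum-replicate-zero n)
∑-𝟙-== {suc n} (suc u) = trans (sum-cong-≗ (λ j → cong 𝟙 (==-suc j u))) (∑-𝟙-== u)

𝟙-∨-== : ∀ {n} {u v : Fin n} → ¬ u ≡ v → ∀ j → 𝟙 ((j == u) ∨ (v == j)) ≡ 𝟙 (j == u) ℕ.+ 𝟙 (j == v)
𝟙-∨-== {u = u} {v} u≢v j rewrite ==-sym v j with j ≟ u | j ≟ v
... | yes refl | yes refl = contradiction refl u≢v
... | yes _    | no  _    = refl
... | no  _    | yes _    = refl
... | no  _    | no  _    = refl

∑-𝟙-∨-== : ∀ {n} {u v : Fin n} → ¬ u ≡ v → ∑[ j < n ] 𝟙 ((j == u) ∨ (v == j)) ≡ 2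
∑-𝟙-∨-== {u = u} {v} u≢v = begin
  ∑[ j < _ ] 𝟙 ((j == u) ∨ (v == j))       ≡⟨ sum-cong-≗ (𝟙-∨-== u≢v) ⟩
  ∑[ j < _ ] (𝟙 (j == u) ℕ.+ 𝟙 (j == v))  ≡⟨ ∑-distrib-+ (λ j → 𝟙 (j == u)) (λ j → 𝟙 (j == v)) ⟩
  (∑[ j < _ ] 𝟙 (j == u)) ℕ.+ (∑[ j < _ ] 𝟙 (j == v)) ≡⟨ cong₂ ℕ._+_ (∑-𝟙-== u) (∑-𝟙-== v) ⟩
  2 ∎
  where open ≡-Reasoning

does-≟-true : ∀ b → does (b Bool.≟ true) ≡ b
does-≟-true true  = refl
does-≟-true false = refl

deg≡∑𝟙 : ∀ {n} (G : Graph n) u → deg G u ≡ ∑[ v < n ] 𝟙 (G u v)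
deg≡∑𝟙 G u = trans (length-filter-allFin (λ v → G u v Bool.≟ true))
                   (sum-cong-≗ (λ v → cong 𝟙 (does-≟-true (G u v))))

module _ {n} (G : Graph n) (u v : Fin n) where

  deg-extend-suc : ∀ i → deg (extend G u v) (suc i) ≡ 𝟙 ((i == u) ∨ (v == i)) ℕ.+ deg G i
  deg-extend-suc i = trans (deg≡∑𝟙 (extend G u v) (suc i)) (cong (_ ℕ.+_) (sym (deg≡∑𝟙 G i)))

  ∑deg-extend : ¬ u ≡ v → sum (deg (extend G u v)) ≡ 4 ℕ.+ sum (deg G)
  ∑deg-extend u≢v = begin
    deg (extend G u v) zero ℕ.+ ∑[ i < n ] deg (extend G u v) (suc i)
      ≡⟨ cong₂ ℕ._+_ (trans (deg≡∑𝟙 (extend G u v) zero) (∑-𝟙-∨-== u≢v)) (sum-cong-≗ deg-extend-suc) ⟩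
    2 ℕ.+ ∑[ i < n ] (𝟙 ((i == u) ∨ (v == i)) ℕ.+ deg G i)
      ≡⟨ cong (2 ℕ.+_) (∑-distrib-+ (λ i → 𝟙 ((i == u) ∨ (v == i))) (deg G)) ⟩
    2 ℕ.+ ((∑[ i < n ] 𝟙 ((i == u) ∨ (v == i))) ℕ.+ sum (deg G))
      ≡⟨ cong (λ k → 2 ℕ.+ (k ℕ.+ sum (deg G))) (∑-𝟙-∨-== u≢v) ⟩
    4 ℕ.+ sum (deg G) ∎
    where open ≡-Reasoning

Built2Tree-irreflexive : ∀ {n H} → Built2Tree n H → ∀ i → H i i ≡ false
Built2Tree-irreflexive base zero             = refl
Built2Tree-irreflexive base (suc zero)       = refl
Built2Tree-irreflexive base (suc (suc zero)) = refl
Built2Tree-irreflexive (step _ _ _ _) zero    = refl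
Built2Tree-irreflexive (step _ _ b _) (suc i) = Built2Tree-irreflexive b i

Built2Tree-edge-ends-distinct : ∀ {n H} {u v : Fin n} → Built2Tree n H → H u v ≡ true → ¬ u ≡ v
Built2Tree-edge-ends-distinct {u = u} b uv refl with trans (sym (Built2Tree-irreflexive b u)) uv
... | ()

Built2Tree-∑deg : ∀ {n H} → Built2Tree n H → sum (deg H) ℕ.+ 6 ≡ 4 * n
Built2Tree-∑deg base = refl
Built2Tree-∑deg {suc n} (step {G = G} u v b uv) = begin
  sum (deg (extend G u v)) ℕ.+ 6  ≡⟨ cong (ℕ._+ 6) (∑deg-extend G u v (Built2Tree-edge-ends-distinct b uv)) ⟩
  4 ℕ.+ sum (deg G) ℕ.+ 6         ≡⟨ +-assoc 4 (sum (deg G)) 6 ⟩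
  4 ℕ.+ (sum (deg G) ℕ.+ 6)       ≡⟨ cong (4 ℕ.+_) (Built2Tree-∑deg b) ⟩
  4 ℕ.+ 4 * n                     ≡⟨ *-suc 4 n ⟨
  4 * suc n                       ∎
  where open ≡-Reasoning

Isomorphic-deg : ∀ {n} {G H : Graph n} ((σ , _) : Isomorphic G H) →
                 ∀ i → deg G i ≡ deg H (Inverse.to σ i)
Isomorphic-deg {G = G} {H} (σ , G≅H) i = begin
  deg G i                                   ≡⟨ deg≡∑𝟙 G i ⟩
  ∑[ j < _ ] 𝟙 (G i j)                      ≡⟨ sum-cong-≗ (λ j → cong 𝟙 (G≅H i j)) ⟩
  ∑[ j < _ ] 𝟙 (H (to i) (to j))            ≡⟨ sum-permute (λ j → 𝟙 (H (to i) j)) σ ⟨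
  ∑[ j < _ ] 𝟙 (H (to i) j)                 ≡⟨ deg≡∑𝟙 H (to i) ⟨
  deg H (to i)                              ∎
  where
  open ≡-Reasoning
  to : Fin _ → Fin _
  to = Inverse.to σ

Isomorphic-∑deg : ∀ {n} {G H : Graph n} → Isomorphic G H → sum (deg G) ≡ sum (deg H)
Isomorphic-∑deg {H = H} G≅H@(σ , _) =
  trans (sum-cong-≗ (Isomorphic-deg {H = H} G≅H)) (sym (sum-permute (deg H) σ))

Is2Tree-∑deg : ∀ {n} {G : Graph n} → Is2Tree G → sum (deg G) ℕ.+ 6 ≡ 4 * n
Is2Tree-∑deg (H , b , G≅H) = trans (cong (ℕ._+ 6) (Isomorphic-∑deg G≅H)) (Built2Tree-∑deg b)

private
  basis₁ : ∀ a b c → a ≡ a * 1 ℕ.+ b * 0 ℕ.+ c * 0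
  basis₁ = solve-∀
  basis₂ : ∀ a b c → b ≡ a * 0 ℕ.+ b * 1 ℕ.+ c * 0
  basis₂ = solve-∀
  basis₃ : ∀ a b c → c ≡ a * 0 ℕ.+ b * 0 ℕ.+ c * 1
  basis₃ = solve-∀

module _ {n} (G : Graph n) (c : Fin n) where

  tailIndicator : ℕ → Fin n → ℕ
  tailIndicator d v = 𝟙 (does (¬? (v ≟ c) ×-dec (deg G v ℕ.≟ d)))

  tailCount≡∑ : ∀ d → tailCount G c d ≡ sum (tailIndicator d)
  tailCount≡∑ d = length-filter-allFin (λ v → ¬? (v ≟ c) ×-dec (deg G v ℕ.≟ d))

  module _ {Δ : ℕ} (central : OneCentral G Δ c) (tails : TailSet23 G c) (φ : ℕ → ℕ) where

    weight-by-class : ∀ v → φ (deg G v) ≡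
      φ Δ * 𝟙 (v == c) ℕ.+ φ 2 * tailIndicator 2 v ℕ.+ φ 3 * tailIndicator 3 v
    weight-by-class v with v ≟ c
    ... | yes refl = trans (cong φ (proj₁ (proj₂ (proj₂ central)))) (basis₁ (φ Δ) (φ 2) (φ 3))
    ... | no v≢c with tails v v≢c
    ...   | inj₁ deg≡2 rewrite deg≡2 = basis₂ (φ Δ) (φ 2) (φ 3)
    ...   | inj₂ deg≡3 rewrite deg≡3 = basis₃ (φ Δ) (φ 2) (φ 3)

    ∑-weight-by-class : ∑[ v < n ] φ (deg G v) ≡ φ Δ ℕ.+ φ 2 * tailCount G c 2 ℕ.+ φ 3 * tailCount G c 3
    ∑-weight-by-class = begin
      ∑[ v < n ] φ (deg G v)
        ≡⟨ sum-cong-≗ weight-by-class ⟩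
      ∑[ v < n ] (φ Δ * 𝟙 (v == c) ℕ.+ φ 2 * tailIndicator 2 v ℕ.+ φ 3 * tailIndicator 3 v)
        ≡⟨ ∑-linear₃ (φ Δ) (φ 2) (φ 3) (λ v → 𝟙 (v == c)) (tailIndicator 2) (tailIndicator 3) ⟩
      φ Δ * (∑[ v < n ] 𝟙 (v == c)) ℕ.+ φ 2 * sum (tailIndicator 2) ℕ.+ φ 3 * sum (tailIndicator 3)
        ≡⟨ cong₂ ℕ._+_ (cong₂ ℕ._+_ (trans (cong (φ Δ *_) (∑-𝟙-== c)) (*-identityʳ (φ Δ)))
                                   (cong (φ 2 *_) (sym (tailCount≡∑ 2))))
                       (cong (φ 3 *_) (sym (tailCount≡∑ 3))) ⟩
      φ Δ ℕ.+ φ 2 * tailCount G c 2 ℕ.+ φ 3 * tailCount G c 3 ∎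
      where open ≡-Reasoning

tail-counts : ∀ {n Δ x y} → Δ ℕ.+ 2 * y ℕ.+ 3 * x ℕ.+ 6 ≡ 4 * n → n ≡ 1 ℕ.+ y ℕ.+ x →
              x ℕ.+ 4 ℕ.+ Δ ≡ 2 * n × y ℕ.+ n ≡ Δ ℕ.+ 3
tail-counts {Δ = Δ} {x} {y} degreeSum refl = x-eq , y-eq
  where
  open ≡-Reasoning
  core-degree : Δ ℕ.+ 2 ≡ 2 * y ℕ.+ x
  core-degree = +-cancelʳ-≡ (2 * y ℕ.+ 3 * x ℕ.+ 4) _ _ (begin
    Δ ℕ.+ 2 ℕ.+ (2 * y ℕ.+ 3 * x ℕ.+ 4) ≡⟨ solve (Δ ∷ x ∷ y ∷ []) ⟩
    Δ ℕ.+ 2 * y ℕ.+ 3 * x ℕ.+ 6         ≡⟨ degreeSum ⟩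
    4 * (1 ℕ.+ y ℕ.+ x)                   ≡⟨ solve (x ∷ y ∷ []) ⟩
    2 * y ℕ.+ x ℕ.+ (2 * y ℕ.+ 3 * x ℕ.+ 4) ∎)
  x-eq : x ℕ.+ 4 ℕ.+ Δ ≡ 2 * (1 ℕ.+ y ℕ.+ x)
  x-eq = begin
    x ℕ.+ 4 ℕ.+ Δ         ≡⟨ solve (Δ ∷ x ∷ []) ⟩
    x ℕ.+ 2 ℕ.+ (Δ ℕ.+ 2) ≡⟨ cong (x ℕ.+ 2 ℕ.+_) core-degree ⟩
    x ℕ.+ 2 ℕ.+ (2 * y ℕ.+ x) ≡⟨ solve (x ∷ y ∷ []) ⟩
    2 * (1 ℕ.+ y ℕ.+ x)   ∎
  y-eq : y ℕ.+ (1 ℕ.+ y ℕ.+ x) ≡ Δ ℕ.+ 3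
  y-eq = begin
    y ℕ.+ (1 ℕ.+ y ℕ.+ x) ≡⟨ solve (x ∷ y ∷ []) ⟩
    1 ℕ.+ (2 * y ℕ.+ x)   ≡⟨ cong (1 ℕ.+_) core-degree ⟨
    1 ℕ.+ (Δ ℕ.+ 2)       ≡⟨ solve (Δ ∷ []) ⟩
    Δ ℕ.+ 3               ∎

m+n+o≡p⇒+m≡+p-+n-+o : ∀ {m n o p} → m ℕ.+ n ℕ.+ o ≡ p → + m ≡ + p - + n - + o
m+n+o≡p⇒+m≡+p-+n-+o {m} {n} {o} refl rewrite ℤ.pos-+ (m ℕ.+ n) o | ℤ.pos-+ m n =
  ring (+ m) (+ n) (+ o)
  where
  ring : ∀ (a b c : ℤ) → a ≡ a + b + c - b - c
  ring = ℤ-Solver.solve-∀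

m+n≡o+p⇒+m≡+o-+n++p : ∀ {m n o p} → m ℕ.+ n ≡ o ℕ.+ p → + m ≡ + o - + n + + p
m+n≡o+p⇒+m≡+o-+n++p {m} {n} {o} {p} eq = begin
  + m                   ≡⟨ cancel (+ m) (+ n) ⟨
  + m + + n - + n       ≡⟨ cong (_- + n) (ℤ.pos-+ m n) ⟨
  + (m ℕ.+ n) - + n     ≡⟨ cong (λ k → + k - + n) eq ⟩
  + (o ℕ.+ p) - + n     ≡⟨ cong (_- + n) (ℤ.pos-+ o p) ⟩
  + o + + p - + n       ≡⟨ reorder (+ o) (+ n) (+ p) ⟩
  + o - + n + + p       ∎
  where
  open ≡-Reasoning
  cancel : ∀ (a b : ℤ) → a + b - b ≡ a
  cancel = ℤ-Solver.solve-∀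
  reorder : ∀ (a b c : ℤ) → a + c - b ≡ a - b + c
  reorder = ℤ-Solver.solve-∀

lemma3p1 : (n : ℕ) (G : Graph n) (Δ : ℕ) (c : Fin n) →
    Is2Tree G → OneCentral G Δ c → TailSet23 G c →
    (+ tailCount G c 3 ≡ + (2 Data.Nat.* n) - + 4 - + Δ)
    Data.Product.× (+ tailCount G c 2 ≡ + Δ - + n + + 3)
lemma3p1 n G Δ c twoTree central tails =
  map m+n+o≡p⇒+m≡+p-+n-+o m+n≡o+p⇒+m≡+o-+n++p (tail-counts degreeSum vertexCount)
  where
  open ≡-Reasoning
  x y : ℕ
  x = tailCount G c 3
  y = tailCount G c 2
  degreeSum : Δ ℕ.+ 2 * y ℕ.+ 3 * x ℕ.+ 6 ≡ 4 * n
  degreeSum = trans (cong (ℕ._+ 6) (sym (∑-weight-by-class G c central tails id))) (Is2Tree-∑deg twoTree)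
  vertexCount : n ≡ 1 ℕ.+ y ℕ.+ x
  vertexCount = begin
    n                           ≡⟨ sum-replicate-one n ⟨
    sum (replicate n 1)         ≡⟨ ∑-weight-by-class G c central tails (const 1) ⟩
    1 ℕ.+ 1 * y ℕ.+ 1 * x       ≡⟨ cong₂ (λ k l → 1 ℕ.+ k ℕ.+ l) (*-identityˡ y) (*-identityˡ x) ⟩
    1 ℕ.+ y ℕ.+ x               ∎
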